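{- Let $F$ be a gene tree forest, $H(F)$ its associated edge-labeled graph, and $f'=f(H(F))$ its cut-set function. If $f'$ is not submodular, then there exist an internal vertex $x$ of $F$, with label $a$, and two subsets $A,B\subseteq L(F)$ such that either (1) $a\in A_1\cap AC$ and $a\notin AB\cup C_1\cup BC\cup B_1$, or (2) $a\in B_1\cap BC$ and $a\notin AB\cup C_1\cup AC\cup A_1$; moreover, such an $x$ is necessarily not an apparent duplication, i.e. $L(x_l)\cap L(x_r)=\emptyset$.
   Context: A gene tree is a rooted binary tree (internal vertex $x$ has children $x_l,x_r$) whose leaves are labeled by genome labels (labels may repeat); a gene tree forest $F$ is a finite set of gene trees. $L(x)$ is the set of leaf labels in the subtree rooted at $x$, $L(F)$ the set of all leaf labels. Label the internal vertices of $F$ injectively by $1,\dots,m$. $H(F)$ has vertex set $L(F)$ and, for each internal vertex $x$ with label $a$ and each pair of distinct $s,t$ with $\{s,t\}\subseteq L(x_l)$ or $\{s,t\}\subseteq L(x_r)$, an edge between $s$ and $t$ labeled $a$. For an edge-labeled graph $H$ with vertex set $V$, its cut-set function $f(H):2^V\to\mathbb{R}$ maps $X\subseteq V$ to the number of distinct labels on edges with one endpoint in $X$ and the other in $V\setminus X$. A function $f:2^V\to\mathbb{R}$ is submodular if $f(A)+f(B)\geq f(A\cup B)+f(A\cap B)$ for all $A,B\subseteq V$. For $A,B\subseteq L(F)$, define sets of labels of edges of $H(F)$: $AB$: edges with one endpoint in $A\setminus B$ and the other in $B\setminus A$; $C_1$: one endpoint in $A\cap B$, the other not in $A\cup B$;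 $A_1$: one endpoint in $A\setminus B$, the other not in $A\cup B$; $B_1$: one endpoint in $B\setminus A$, the other not in $A\cup B$; $AC$: one endpoint in $A\cap B$, the other in $B\setminus A$; $BC$: one endpoint in $A\cap B$, the other in $A\setminus B$. -}

module Defs where

open import Data.Nat using (ℕ; _+_; _≤_)
open import Data.Fin using (Fin)
open import Data.Fin.Properties using (any?)
open import Data.Fin.Subset using (Subset; _∈_; _∉_; _⊆_; _∪_; _∩_; _─_; ⁅_⁆; Empty)
  renaming (⊥ to ∅)
open import Data.Fin.Subset.Properties using (_∈?_)
open import Data.List using (List; []; _∷_; _++_; length; lookup; filter; foldr)
open import Data.Product using (Σ; ∃; _×_; _,_; proj₁; proj₂)
open import Data.Sum using (_⊎_)
open import Relation.Nullary using (Dec)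
open import Relation.Nullary.Decidable using (_×-dec_; _⊎-dec_)

-- Gene trees over the genome labels Fin n (labels may repeat).
data Tree (n : ℕ) : Set where
  leaf : Fin n → Tree n
  node : Tree n → Tree n → Tree n

Forest : ℕ → Set
Forest n = List (Tree n)

L : ∀ {n} → Tree n → Subset n
L (leaf i) = ⁅ i ⁆
L (node l r) = L l ∪ L r

LF : ∀ {n} → Forest n → Subset n
LF = foldr (λ t S → L t ∪ S) ∅

-- An internal vertex, recorded by its pair of children (x_l , x_r).
Internal : ℕ → Set
Internal n = Tree n × Tree n

internalsT : ∀ {n} → Tree n → List (Internal n)
internalsT (leaf _) = []
internalsT (node l r) = (l , r) ∷ (internalsT l ++ internalsT r)

-- All internal vertices of F (with multiplicity: each occurrence is a vertex).
internals : ∀ {n} → Forest n → List (Internal n)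
internals = foldr (λ t vs → internalsT t ++ vs) []

-- Injective labelling of internal vertices: a label is a position in the list.
Label : ∀ {n} → Forest n → Set
Label F = Fin (length (internals F))

vertex : ∀ {n} (F : Forest n) → Label F → Internal n
vertex F a = lookup (internals F) a

-- H(F) has an edge labelled by (the label of) x between s and t (s ≠ t)
-- iff {s,t} ⊆ L(x_l) or {s,t} ⊆ L(x_r).
EdgeAt : ∀ {n} → Internal n → Fin n → Fin n → Set
EdgeAt (l , r) s t = (s ∈ L l × t ∈ L l) ⊎ (s ∈ L r × t ∈ L r)

-- Some edge labelled by x has one endpoint in P and the other in Q.
-- (Used only with disjoint P, Q, so s ≠ t automatically.)
EdgeBetween : ∀ {n} → Internal n → Subset n → Subset n → Set
EdgeBetween x P Q = ∃ λ s → ∃ λ t → s ∈ P × t ∈ Q × EdgeAt x s t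

edgeBetween? : ∀ {n} (x : Internal n) (P Q : Subset n) → Dec (EdgeBetween x P Q)
edgeBetween? (l , r) P Q =
  any? λ s → any? λ t → (s ∈? P) ×-dec ((t ∈? Q) ×-dec
    (((s ∈? L l) ×-dec (t ∈? L l)) ⊎-dec ((s ∈? L r) ×-dec (t ∈? L r))))

-- Cut-set function f(H(F)) : X ↦ number of distinct labels on edges
-- with one endpoint in X and the other in L(F) ∖ X.
cutSet : ∀ {n} → Forest n → Subset n → ℕ
cutSet F X = length (filter (λ x → edgeBetween? x X (LF F ─ X)) (internals F))

Submodular : ∀ {n} → Subset n → (Subset n → ℕ) → Set
Submodular V f = ∀ A B → A ⊆ V → B ⊆ V → f (A ∪ B) + f (A ∩ B) ≤ f A + f B

module LabelSets {n} (F : Forest n) (A B : Subset n) (a : Label F) where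
  private
    V = LF F
    x = vertex F a
    out = V ─ (A ∪ B)
  InAB = EdgeBetween x (A ─ B) (B ─ A)
  InC₁ = EdgeBetween x (A ∩ B) out
  InA₁ = EdgeBetween x (A ─ B) out
  InB₁ = EdgeBetween x (B ─ A) out
  InAC = EdgeBetween x (A ∩ B) (B ─ A)
  InBC = EdgeBetween x (A ∩ B) (A ─ B)

open import Relation.Nullary using (¬_)
Case1 Case2 : ∀ {n} (F : Forest n) (A B : Subset n) (a : Label F) → Set
Case1 F A B a = let open LabelSets F A B a in
  (InA₁ × InAC) × ¬ (InAB ⊎ InC₁ ⊎ InBC ⊎ InB₁)
Case2 F A B a = let open LabelSets F A B a in
  (InB₁ × InBC) × ¬ (InAB ⊎ InC₁ ⊎ InAC ⊎ InA₁)

NotApparentDup : ∀ {n} → Internal n → Set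
NotApparentDup (l , r) = Empty (L l ∩ L r)

-- Submodularity of a cut-set function can be checked one label at a time: a
-- label counts once towards f(X) when it crosses the cut of X, so it suffices
-- that a label crossing the cuts of both A ∪ B and A ∩ B crosses those of both
-- A and B.  The cut of B is crossed exactly by the labels in AB ∪ C₁ ∪ BC ∪ B₁,
-- that of A by those in AB ∪ C₁ ∪ AC ∪ A₁; those of A ∪ B and A ∩ B are crossed
-- through A₁ ∪ B₁ ∪ C₁ and BC ∪ AC ∪ C₁.  So a label crossing the cuts of A ∪ B
-- and A ∩ B but not that of B lies in case (1), and one missing the cut of A
-- lies in case (2).
-- A label whose children share a leaf label s cannot be in either case: every
-- edge with that label moves to an edge at s, and wherever s lies relative to A
-- and B this produces an edge in one of the forbidden sets.
module Submission where

open import Defs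
open import Data.Nat using (ℕ)
open import Data.Fin.Subset using (Subset; _⊆_)
open import Data.Product using (Σ; ∃; _×_)
open import Data.Sum using (_⊎_)
open import Relation.Nullary using (¬_)

open import Data.Nat using (_+_; _≤_; z≤n)
open import Data.Nat.Properties using (≤-refl; +-mono-≤; m≤m+n; +-commutativeSemigroup)
open import Algebra.Properties.CommutativeSemigroup +-commutativeSemigroup using (interchange)
open import Data.Fin using (Fin)
import Data.Fin as Fin
open import Data.Fin.Properties using (any?)
open import Data.Fin.Subset using (_∈_; _∉_; _∪_; _∩_; _─_; inside)
open import Data.Fin.Subset.Properties
  using (_∈?_; _⊆?_; anySubset?; x∈p∩q⁺; x∈p∩q⁻; x∈p∪q⁻; x∈p∧x∉q⇒x∈p─q;
         p─q⊆p; p∩q⊆p; p∩q⊆q; p⊆p∪q; q⊆p∪q; ⊆-refl; ⊆-trans)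
open import Data.Vec.Base using (_∷_; here; there)
open import Data.List using (List; []; _∷_; length; lookup; filter)
open import Data.List.Membership.Propositional.Properties using (∈-lookup)
open import Data.List.Relation.Unary.All using (All; []; _∷_)
import Data.List.Relation.Unary.All as All
open import Data.List.Relation.Unary.All.Properties using (++⁺)
open import Data.Product using (_,_; proj₁; proj₂)
open import Data.Sum using (inj₁; inj₂; [_,_]′)
import Data.Sum as Sum
open import Data.Empty using (⊥-elim)
open import Function using (_∘_)
open import Relation.Nullary using (Dec; yes; no; ¬?)
open import Relation.Nullary.Decidable using (_×-dec_; _⊎-dec_)
open import Relation.Unary using (Pred; Decidable)
open import Relation.Binary.Definitions using (Symmetric)
open import Relation.Binary.PropositionalEquality using (_≡_; refl; cong₂)

private
  variable
    n : ℕ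

x∈p─q⇒x∉q : ∀ {x : Fin n} (p q : Subset n) → x ∈ p ─ q → x ∉ q
x∈p─q⇒x∉q (_ ∷ p) (_ ∷ q) (there x∈p─q) (there x∈q) = x∈p─q⇒x∉q p q x∈p─q x∈q
x∈p─q⇒x∉q (_ ∷ p) (inside ∷ q) () here

─-mono : ∀ {p p′ q q′ : Subset n} → p ⊆ p′ → q′ ⊆ q → p ─ q ⊆ p′ ─ q′
─-mono {p = p} {q = q} p⊆p′ q′⊆q x∈p─q =
  x∈p∧x∉q⇒x∈p─q (p⊆p′ (p─q⊆p p q x∈p─q)) (x∈p─q⇒x∉q p q x∈p─q ∘ q′⊆q)

venn : ∀ (p q : Subset n) x → x ∈ p ─ q ⊎ x ∈ q ─ p ⊎ x ∈ p ∩ q ⊎ x ∉ p ∪ q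
venn p q x with x ∈? p | x ∈? q
... | yes x∈p | yes x∈q = inj₂ (inj₂ (inj₁ (x∈p∩q⁺ (x∈p , x∈q))))
... | yes x∈p | no  x∉q = inj₁ (x∈p∧x∉q⇒x∈p─q x∈p x∉q)
... | no  x∉p | yes x∈q = inj₂ (inj₁ (x∈p∧x∉q⇒x∈p─q x∈q x∉p))
... | no  x∉p | no  x∉q = inj₂ (inj₂ (inj₂ ([ x∉p , x∉q ]′ ∘ x∈p∪q⁻ p q)))

indicator : ∀ {p} {P : Set p} → Dec P → ℕ
indicator (yes _) = 1
indicator (no  _) = 0

indicator-+-⊎ : ∀ {P Q : Set} (P? : Dec P) (Q? : Dec Q) → P ⊎ Q → 1 ≤ indicator P? + indicator Q?
indicator-+-⊎ (yes _) Q?     _        = m≤m+n 1 (indicator Q?)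
indicator-+-⊎ (no _)  (yes _) _       = ≤-refl
indicator-+-⊎ (no ¬p) (no ¬q) (inj₁ p) = ⊥-elim (¬p p)
indicator-+-⊎ (no ¬p) (no ¬q) (inj₂ q) = ⊥-elim (¬q q)

module _ {a} {X : Set a} {P Q R S : Pred X a}
         (P? : Decidable P) (Q? : Decidable Q) (R? : Decidable R) (S? : Decidable S) where

  private
    count : ∀ {T : Pred X a} → Decidable T → List X → ℕ
    count T? xs = length (filter T? xs)

    count-∷ : ∀ {T : Pred X a} (T? : Decidable T) x xs →
      count T? (x ∷ xs) ≡ indicator (T? x) + count T? xs
    count-∷ T? x xs with T? x
    ... | yes _ = refl
    ... | no  _ = refl

  length-filter-+-≤ : (xs : List X) →
    (∀ i → let x = lookup xs i in
      indicator (P? x) + indicator (Q? x) ≤ indicator (R? x) + indicator (S? x)) →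
    count P? xs + count Q? xs ≤ count R? xs + count S? xs
  length-filter-+-≤ [] _ = z≤n
  length-filter-+-≤ (x ∷ xs) pointwise = begin
    count P? (x ∷ xs) + count Q? (x ∷ xs)
      ≡⟨ cong₂ _+_ (count-∷ P? x xs) (count-∷ Q? x xs) ⟩
    (indicator (P? x) + count P? xs) + (indicator (Q? x) + count Q? xs)
      ≡⟨ interchange (indicator (P? x)) _ _ _ ⟩
    (indicator (P? x) + indicator (Q? x)) + (count P? xs + count Q? xs)
      ≤⟨ +-mono-≤ (pointwise Fin.zero) (length-filter-+-≤ xs (pointwise ∘ Fin.suc)) ⟩
    (indicator (R? x) + indicator (S? x)) + (count R? xs + count S? xs)
      ≡⟨ interchange (indicator (R? x)) _ _ _ ⟩
    (indicator (R? x) + count R? xs) + (indicator (S? x) + count S? xs)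
      ≡⟨ cong₂ _+_ (count-∷ R? x xs) (count-∷ S? x xs) ⟨
    count R? (x ∷ xs) + count S? (x ∷ xs) ∎
    where open Data.Nat.Properties.≤-Reasoning

Crossing : (Fin n → Fin n → Set) → Subset n → Subset n → Set
Crossing E P Q = ∃ λ s → ∃ λ t → s ∈ P × t ∈ Q × E s t

crossing-mono : ∀ {E : Fin n → Fin n → Set} {P P′ Q Q′} → P ⊆ P′ → Q ⊆ Q′ →
  Crossing E P Q → Crossing E P′ Q′
crossing-mono P⊆P′ Q⊆Q′ (s , t , s∈P , t∈Q , e) = s , t , P⊆P′ s∈P , Q⊆Q′ t∈Q , e

crossing-sym : ∀ {E : Fin n → Fin n → Set} → Symmetric E → ∀ {P Q} →
  Crossing E P Q → Crossing E Q P
crossing-sym E-sym (s , t , s∈P , t∈Q , e) = t , s , t∈Q , s∈P , E-sym e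

Hub : (Fin n → Fin n → Set) → Fin n → Set
Hub E s = ∀ {p q} → E p q → E s q

-- The edges carrying one label of H(F) form the relation E; the label sets of
-- the paper become the propositions In⋯ that E crosses between two regions.
module SingleLabel (E : Fin n → Fin n → Set) (V A B : Subset n) where

  Out : Subset n
  Out = V ─ (A ∪ B)

  InAB InC₁ InA₁ InB₁ InAC InBC : Set
  InAB = Crossing E (A ─ B) (B ─ A)
  InC₁ = Crossing E (A ∩ B) Out
  InA₁ = Crossing E (A ─ B) Out
  InB₁ = Crossing E (B ─ A) Out
  InAC = Crossing E (A ∩ B) (B ─ A)
  InBC = Crossing E (A ∩ B) (A ─ B)

  Case₁ Case₂ : Set
  Case₁ = (InA₁ × InAC) × ¬ (InAB ⊎ InC₁ ⊎ InBC ⊎ InB₁)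
  Case₂ = (InB₁ × InBC) × ¬ (InAB ⊎ InC₁ ⊎ InAC ⊎ InA₁)

  Cut : Subset n → Set
  Cut X = Crossing E X (V ─ X)

  module _ (crossing? : ∀ P Q → Dec (Crossing E P Q)) where

    case₁? : Dec Case₁
    case₁? = (crossing? (A ─ B) Out ×-dec crossing? (A ∩ B) (B ─ A)) ×-dec
      ¬? (crossing? (A ─ B) (B ─ A) ⊎-dec crossing? (A ∩ B) Out ⊎-dec
          crossing? (A ∩ B) (A ─ B) ⊎-dec crossing? (B ─ A) Out)

    case₂? : Dec Case₂
    case₂? = (crossing? (B ─ A) Out ×-dec crossing? (A ∩ B) (A ─ B)) ×-dec
      ¬? (crossing? (A ─ B) (B ─ A) ⊎-dec crossing? (A ∩ B) Out ⊎-dec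
          crossing? (A ∩ B) (B ─ A) ⊎-dec crossing? (A ─ B) Out)

  cut-∪ : Cut (A ∪ B) → InA₁ ⊎ InB₁ ⊎ InC₁
  cut-∪ (s , t , s∈A∪B , t∈Out , e) with venn A B s
  ... | inj₁ s∈A─B                = inj₁ (s , t , s∈A─B , t∈Out , e)
  ... | inj₂ (inj₁ s∈B─A)         = inj₂ (inj₁ (s , t , s∈B─A , t∈Out , e))
  ... | inj₂ (inj₂ (inj₁ s∈A∩B))  = inj₂ (inj₂ (s , t , s∈A∩B , t∈Out , e))
  ... | inj₂ (inj₂ (inj₂ s∉A∪B))  = ⊥-elim (s∉A∪B s∈A∪B)

  cut-∩ : Cut (A ∩ B) → InBC ⊎ InAC ⊎ InC₁
  cut-∩ (s , t , s∈A∩B , t∈V─A∩B , e) with venn A B t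
  ... | inj₁ t∈A─B                = inj₁ (s , t , s∈A∩B , t∈A─B , e)
  ... | inj₂ (inj₁ t∈B─A)         = inj₂ (inj₁ (s , t , s∈A∩B , t∈B─A , e))
  ... | inj₂ (inj₂ (inj₁ t∈A∩B))  = ⊥-elim (x∈p─q⇒x∉q V (A ∩ B) t∈V─A∩B t∈A∩B)
  ... | inj₂ (inj₂ (inj₂ t∉A∪B))  =
    inj₂ (inj₂ (s , t , s∈A∩B , x∈p∧x∉q⇒x∈p─q (p─q⊆p V (A ∩ B) t∈V─A∩B) t∉A∪B , e))

  module _ (E-sym : Symmetric E) where

    module _ {s : Fin n} (s∈V : s ∈ V) (hub : Hub E s) where

      private
        hubʳ : ∀ {p q} → E p q → E p s
        hubʳ = E-sym ∘ hub ∘ E-sym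

        region : s ∈ A ─ B ⊎ s ∈ B ─ A ⊎ s ∈ A ∩ B ⊎ s ∈ Out
        region = Sum.map₂ (Sum.map₂ (Sum.map₂ (x∈p∧x∉q⇒x∈p─q s∈V))) (venn A B s)

      hub⇒¬Case₁ : ¬ Case₁
      hub⇒¬Case₁ (((_ , q , _ , q∈Out , e) , (u , v , u∈A∩B , v∈B─A , e′)) , none) with region
      ... | inj₁ s∈A─B               = none (inj₁ (s , v , s∈A─B , v∈B─A , hub e′))
      ... | inj₂ (inj₁ s∈B─A)        = none (inj₂ (inj₂ (inj₂ (s , q , s∈B─A , q∈Out , hub e))))
      ... | inj₂ (inj₂ (inj₁ s∈A∩B)) = none (inj₂ (inj₁ (s , q , s∈A∩B , q∈Out , hub e)))
      ... | inj₂ (inj₂ (inj₂ s∈Out)) = none (inj₂ (inj₁ (u , s , u∈A∩B , s∈Out , hubʳ e′)))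

      hub⇒¬Case₂ : ¬ Case₂
      hub⇒¬Case₂ (((_ , q , _ , q∈Out , e) , (u , v , u∈A∩B , v∈A─B , e′)) , none) with region
      ... | inj₁ s∈A─B               = none (inj₂ (inj₂ (inj₂ (s , q , s∈A─B , q∈Out , hub e))))
      ... | inj₂ (inj₁ s∈B─A)        = none (inj₁ (v , s , v∈A─B , s∈B─A , hubʳ (E-sym (hub e′))))
      ... | inj₂ (inj₂ (inj₁ s∈A∩B)) = none (inj₂ (inj₁ (s , q , s∈A∩B , q∈Out , hub e)))
      ... | inj₂ (inj₂ (inj₂ s∈Out)) = none (inj₂ (inj₁ (u , s , u∈A∩B , s∈Out , hubʳ e′)))

    module _ (A⊆V : A ⊆ V) (B⊆V : B ⊆ V) where

      cutA-from : InAB ⊎ InC₁ ⊎ InAC ⊎ InA₁ → Cut A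
      cutA-from (inj₁ ab)               = crossing-mono (p─q⊆p A B) (─-mono B⊆V ⊆-refl) ab
      cutA-from (inj₂ (inj₁ c₁))        = crossing-mono (p∩q⊆p A B) (─-mono ⊆-refl (p⊆p∪q B)) c₁
      cutA-from (inj₂ (inj₂ (inj₁ ac))) = crossing-mono (p∩q⊆p A B) (─-mono B⊆V ⊆-refl) ac
      cutA-from (inj₂ (inj₂ (inj₂ a₁))) = crossing-mono (p─q⊆p A B) (─-mono ⊆-refl (p⊆p∪q B)) a₁

      cutB-from : InAB ⊎ InC₁ ⊎ InBC ⊎ InB₁ → Cut B
      cutB-from (inj₁ ab)               =
        crossing-mono (p─q⊆p B A) (─-mono A⊆V ⊆-refl) (crossing-sym E-sym ab)
      cutB-from (inj₂ (inj₁ c₁))        = crossing-mono (p∩q⊆q A B) (─-mono ⊆-refl (q⊆p∪q A B)) c₁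
      cutB-from (inj₂ (inj₂ (inj₁ bc))) = crossing-mono (p∩q⊆q A B) (─-mono A⊆V ⊆-refl) bc
      cutB-from (inj₂ (inj₂ (inj₂ b₁))) = crossing-mono (p─q⊆p B A) (─-mono ⊆-refl (q⊆p∪q A B)) b₁

      cut-∪⇒cutA⊎cutB : Cut (A ∪ B) → Cut A ⊎ Cut B
      cut-∪⇒cutA⊎cutB u with cut-∪ u
      ... | inj₁ a₁        = inj₁ (cutA-from (inj₂ (inj₂ (inj₂ a₁))))
      ... | inj₂ (inj₁ b₁) = inj₂ (cutB-from (inj₂ (inj₂ (inj₂ b₁))))
      ... | inj₂ (inj₂ c₁) = inj₁ (cutA-from (inj₂ (inj₁ c₁)))

      cut-∩⇒cutA⊎cutB : Cut (A ∩ B) → Cut A ⊎ Cut B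
      cut-∩⇒cutA⊎cutB i with cut-∩ i
      ... | inj₁ bc        = inj₂ (cutB-from (inj₂ (inj₂ (inj₁ bc))))
      ... | inj₂ (inj₁ ac) = inj₁ (cutA-from (inj₂ (inj₂ (inj₁ ac))))
      ... | inj₂ (inj₂ c₁) = inj₁ (cutA-from (inj₂ (inj₁ c₁)))

      ¬cutB⇒Case₁ : Cut (A ∪ B) → Cut (A ∩ B) → ¬ Cut B → Case₁
      ¬cutB⇒Case₁ u i ¬b = (a₁ , ac) , ¬b ∘ cutB-from
        where
        a₁ : InA₁
        a₁ with cut-∪ u
        ... | inj₁ a₁        = a₁
        ... | inj₂ (inj₁ b₁) = ⊥-elim (¬b (cutB-from (inj₂ (inj₂ (inj₂ b₁)))))
        ... | inj₂ (inj₂ c₁) = ⊥-elim (¬b (cutB-from (inj₂ (inj₁ c₁))))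
        ac : InAC
        ac with cut-∩ i
        ... | inj₁ bc        = ⊥-elim (¬b (cutB-from (inj₂ (inj₂ (inj₁ bc)))))
        ... | inj₂ (inj₁ ac) = ac
        ... | inj₂ (inj₂ c₁) = ⊥-elim (¬b (cutB-from (inj₂ (inj₁ c₁))))

      ¬cutA⇒Case₂ : Cut (A ∪ B) → Cut (A ∩ B) → ¬ Cut A → Case₂
      ¬cutA⇒Case₂ u i ¬a = (b₁ , bc) , ¬a ∘ cutA-from
        where
        b₁ : InB₁
        b₁ with cut-∪ u
        ... | inj₁ a₁        = ⊥-elim (¬a (cutA-from (inj₂ (inj₂ (inj₂ a₁)))))
        ... | inj₂ (inj₁ b₁) = b₁
        ... | inj₂ (inj₂ c₁) = ⊥-elim (¬a (cutA-from (inj₂ (inj₁ c₁))))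
        bc : InBC
        bc with cut-∩ i
        ... | inj₁ bc        = bc
        ... | inj₂ (inj₁ ac) = ⊥-elim (¬a (cutA-from (inj₂ (inj₂ (inj₁ ac)))))
        ... | inj₂ (inj₂ c₁) = ⊥-elim (¬a (cutA-from (inj₂ (inj₁ c₁))))

      indicator-submodular : ¬ Case₁ → ¬ Case₂ →
        (U? : Dec (Cut (A ∪ B))) (I? : Dec (Cut (A ∩ B))) (A? : Dec (Cut A)) (B? : Dec (Cut B)) →
        indicator U? + indicator I? ≤ indicator A? + indicator B?
      indicator-submodular _ _ (no _) (no _) _ _ = z≤n
      indicator-submodular _ _ (yes u) (no _) A? B? = indicator-+-⊎ A? B? (cut-∪⇒cutA⊎cutB u)
      indicator-submodular _ _ (no _) (yes i) A? B? = indicator-+-⊎ A? B? (cut-∩⇒cutA⊎cutB i)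
      indicator-submodular _ _ (yes _) (yes _) (yes _) (yes _) = ≤-refl
      indicator-submodular ¬case₁ _ (yes u) (yes i) _ (no ¬b) = ⊥-elim (¬case₁ (¬cutB⇒Case₁ u i ¬b))
      indicator-submodular _ ¬case₂ (yes u) (yes i) (no ¬a) _ = ⊥-elim (¬case₂ (¬cutA⇒Case₂ u i ¬a))

EdgeAt-sym : (x : Internal n) → Symmetric (EdgeAt x)
EdgeAt-sym x (inj₁ (s∈l , t∈l)) = inj₁ (t∈l , s∈l)
EdgeAt-sym x (inj₂ (s∈r , t∈r)) = inj₂ (t∈r , s∈r)

shared-leaf⇒Hub : ∀ (x : Internal n) {s} → s ∈ L (proj₁ x) → s ∈ L (proj₂ x) → Hub (EdgeAt x) s
shared-leaf⇒Hub _ s∈l _ (inj₁ (_ , q∈l)) = inj₁ (s∈l , q∈l)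
shared-leaf⇒Hub _ _ s∈r (inj₂ (_ , q∈r)) = inj₂ (s∈r , q∈r)

ChildrenWithin : Subset n → Internal n → Set
ChildrenWithin S x = L (proj₁ x) ∪ L (proj₂ x) ⊆ S

ChildrenWithin-mono : ∀ {S S′ : Subset n} {x} → S ⊆ S′ → ChildrenWithin S x → ChildrenWithin S′ x
ChildrenWithin-mono S⊆S′ within = ⊆-trans within S⊆S′

internalsT-within : (t : Tree n) → All (ChildrenWithin (L t)) (internalsT t)
internalsT-within (leaf _)   = []
internalsT-within (node l r) = ⊆-refl ∷ ++⁺
  (All.map (λ {x} → ChildrenWithin-mono {x = x} (p⊆p∪q (L r))) (internalsT-within l))
  (All.map (λ {x} → ChildrenWithin-mono {x = x} (q⊆p∪q (L l) (L r))) (internalsT-within r))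

internals-within : (F : Forest n) → All (ChildrenWithin (LF F)) (internals F)
internals-within []      = []
internals-within (t ∷ F) = ++⁺
  (All.map (λ {x} → ChildrenWithin-mono {x = x} (p⊆p∪q (LF F))) (internalsT-within t))
  (All.map (λ {x} → ChildrenWithin-mono {x = x} (q⊆p∪q (L t) (LF F))) (internals-within F))

notApparentDup : (F : Forest n) (a : Label F) (A B : Subset n) →
  Case1 F A B a ⊎ Case2 F A B a → NotApparentDup (vertex F a)
notApparentDup F a A B case (s , s∈l∩r) =
  [ hub⇒¬Case₁ (EdgeAt-sym x) s∈V hub , hub⇒¬Case₂ (EdgeAt-sym x) s∈V hub ]′ case
  where
  x = vertex F a
  open SingleLabel (EdgeAt x) (LF F) A B
  s∈l = proj₁ (x∈p∩q⁻ _ _ s∈l∩r)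
  hub = shared-leaf⇒Hub x s∈l (proj₂ (x∈p∩q⁻ _ _ s∈l∩r))
  s∈V = All.lookup (internals-within F) (∈-lookup {xs = internals F} a) (p⊆p∪q _ s∈l)

cutSet-submodular : (F : Forest n) →
  (∀ A B → A ⊆ LF F → B ⊆ LF F → ∀ a → ¬ (Case1 F A B a ⊎ Case2 F A B a)) →
  Submodular (LF F) (cutSet F)
cutSet-submodular F noCase A B A⊆V B⊆V =
  length-filter-+-≤ (crosses (A ∪ B)) (crosses (A ∩ B)) (crosses A) (crosses B) (internals F) λ a →
    let x = vertex F a in
    SingleLabel.indicator-submodular (EdgeAt x) (LF F) A B (EdgeAt-sym x) A⊆V B⊆V
      (noCase A B A⊆V B⊆V a ∘ inj₁) (noCase A B A⊆V B⊆V a ∘ inj₂)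
      (crosses (A ∪ B) x) (crosses (A ∩ B) x) (crosses A x) (crosses B x)
  where
  crosses : (X : Subset _) (x : Internal _) → Dec (EdgeBetween x X (LF F ─ X))
  crosses X x = edgeBetween? x X (LF F ─ X)

CaseWitness : Forest n → Set
CaseWitness {n} F = ∃ λ (a : Label F) → ∃ λ (A : Subset n) → ∃ λ (B : Subset n) →
  A ⊆ LF F × B ⊆ LF F × (Case1 F A B a ⊎ Case2 F A B a)

caseWitness? : (F : Forest n) → Dec (CaseWitness F)
caseWitness? F = any? λ a → anySubset? λ A → anySubset? λ B →
  (A ⊆? LF F) ×-dec (B ⊆? LF F) ×-dec (case₁? A B a ⊎-dec case₂? A B a)
  where
  case₁? case₂? : ∀ A B a → Dec _
  case₁? A B a = SingleLabel.case₁? (EdgeAt (vertex F a)) (LF F) A B (edgeBetween? (vertex F a))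
  case₂? A B a = SingleLabel.case₂? (EdgeAt (vertex F a)) (LF F) A B (edgeBetween? (vertex F a))

lemma4 : ∀ {n} (F : Forest n) → ¬ Submodular (LF F) (cutSet F) →
  (∃ λ (a : Label F) → ∃ λ (A : Subset n) → ∃ λ (B : Subset n) →
    A ⊆ LF F × B ⊆ LF F × (Case1 F A B a ⊎ Case2 F A B a)
      × NotApparentDup (vertex F a))
  × (∀ (a : Label F) (A B : Subset n) → A ⊆ LF F → B ⊆ LF F →
      Case1 F A B a ⊎ Case2 F A B a → NotApparentDup (vertex F a))
lemma4 F nonSubmodular with caseWitness? F
... | yes (a , A , B , A⊆V , B⊆V , case) =
  (a , A , B , A⊆V , B⊆V , case , notApparentDup F a A B case) ,
  λ a A B _ _ → notApparentDup F a A B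
... | no noWitness = ⊥-elim (nonSubmodular (cutSet-submodular F
  λ A B A⊆V B⊆V a case → noWitness (a , A , B , A⊆V , B⊆V , case)))
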